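{- Let $T,S\subseteq\mathbb{Z}_{>0}$ be finite and let $x$ be an integer such that $T_{\ge x}\preceq S_{>x}$. Then $$T\triangleleft S=(T_{<x}\triangleleft S_{\le x})\sqcup(T_{\ge x}\triangleleft S_{>x}).$$
   Context: For finite $T,S\subseteq\mathbb{Z}_{>0}$, $T\triangleleft S$ is computed by going through $s\in S$ from largest to smallest; each $s$ picks the largest not-yet-picked $t\in T$ with $t<s$, if one exists; $T\triangleleft S$ is the set of picked elements. $S(i)$ denotes the $i$-th smallest element of $S$; $T_{<x}=\{t\in T:t<x\}$, and similarly $T_{\ge x}$, $S_{\le x}$, $S_{>x}$. Domination: $T\preceq S$ means $|T|\ge|S|$ and $T(i)<S(i)$ for all $i\in[|S|]$. -}

module Defs where

open import Data.Nat using (ℕ; zero; suc; _<_; _≤_; _<?_; _≟_)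
open import Data.Integer as ℤ using (ℤ; +_)
open import Data.Integer.Properties as ℤP using ()
open import Data.List using (List; []; _∷_; filter; reverse; length; lookup)
open import Data.List.Relation.Unary.All using (All)
open import Data.List.Relation.Unary.Linked using (Linked)
open import Data.List.Membership.Propositional using (_∈_)
open import Data.Fin using (Fin; cast)
open import Data.Fin as Fin using (inject≤)
open import Data.Maybe using (Maybe; just; nothing)
open import Data.Product using (_×_)
open import Data.Sum using (_⊎_)
open import Data.Empty using (⊥)
open import Relation.Nullary using (yes; no; ¬_; ¬?)

-- A finite subset of ℤ_{>0}, represented canonically as a strictly
-- increasing list of positive naturals (so S(i) = lookup S i, 0-indexed).
IsFinSetPos : List ℕ → Set
IsFinSetPos L = Linked _<_ L × All (λ n → 0 < n) L

largestBelow : ℕ → List ℕ → Maybe ℕ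
largestBelow s [] = nothing
largestBelow s (t ∷ ts) with largestBelow s ts | t <? s
... | r        | no _ = r
... | nothing  | yes _ = just t
... | just u   | yes _ with u <? t
...   | yes _ = just t
...   | no _  = just u

removeElt : ℕ → List ℕ → List ℕ
removeElt t = filter (λ u → ¬? (u ≟ t))

go : List ℕ → List ℕ → List ℕ
go avail [] = []
go avail (s ∷ ss) with largestBelow s avail
... | nothing = go avail ss
... | just t  = t ∷ go (removeElt t avail) ss

-- T ◁ S : S is processed from largest to smallest (S is increasing, so reverse).
_◁_ : List ℕ → List ℕ → List ℕ
T ◁ S = go T (reverse S)

_<ₓ_ : List ℕ → ℤ → List ℕ
T <ₓ x = filter (λ t → (+ t) ℤP.<? x) T

_≥ₓ_ : List ℕ → ℤ → List ℕ
T ≥ₓ x = filter (λ t → x ℤP.≤? (+ t)) T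

_≤ₓ_ : List ℕ → ℤ → List ℕ
S ≤ₓ x = filter (λ s → (+ s) ℤP.≤? x) S

_>ₓ_ : List ℕ → ℤ → List ℕ
S >ₓ x = filter (λ s → x ℤP.<? (+ s)) S

record _⪯_ (T S : List ℕ) : Set where
  field
    len≥ : length S ≤ length T
    pointwise : (i : Fin (length S)) → lookup T (inject≤ i len≥) < lookup S i

_≡_⊔_ : List ℕ → List ℕ → List ℕ → Set
C ≡ A ⊔ B = ((n : ℕ) → n ∈ C → n ∈ A ⊎ n ∈ B)
          × ((n : ℕ) → n ∈ A ⊎ n ∈ B → n ∈ C)
          × ((n : ℕ) → n ∈ A → n ∈ B → ⊥)

{-# OPTIONS --safe #-}
-- Processing S from the top, the elements of S_{>x} come first.  By the domination
-- hypothesis, the i-th largest of them has a witness in T_{≥x} below it, and these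
-- witnesses are decreasing; so each s ∈ S_{>x} finds an element ≥ x below it, i.e. its
-- pick is the same as in T_{≥x}, and all witnesses still to be used survive the removal.
-- Afterwards every s ∈ S_{≤x} can only pick elements < x, none of which has been used.
module Submission where

open import Defs
open import Function using (_∘_; flip)
open import Data.Nat using (ℕ; _<_; _≤_; _>_; _<?_; _≟_; s≤s)
open import Data.Nat.Properties using (≤-refl; ≤-trans; <⇒≤; ≮⇒≥; <-trans; ≤-antisym; <-≤-trans; <⇒≢)
open import Data.Integer as ℤ using (ℤ; +_; +≤+; +<+)
import Data.Integer.Properties as ℤP
open import Data.List using (List; []; _∷_; _++_; filter; reverse; length; lookup; take)
open import Data.List.Properties using (reverse-++; unfold-reverse; filter-all; filter-none; filter-accept; filter-reject)
open import Data.List.Relation.Unary.All as All using (All; []; _∷_)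
open import Data.List.Relation.Unary.All.Properties using (all-filter)
open import Data.List.Relation.Unary.Any using (here; there)
open import Data.List.Relation.Unary.Any.Properties using (reverse⁻)
open import Data.List.Relation.Unary.AllPairs using (AllPairs; []; _∷_)
import Data.List.Relation.Unary.AllPairs.Properties as AllPairs
open import Data.List.Relation.Unary.Linked.Properties using (Linked⇒AllPairs)
open import Data.List.Relation.Binary.Pointwise as Pointwise using (Pointwise; []; _∷_)
import Data.List.Relation.Binary.Sublist.Propositional as Sublist
open import Data.List.Relation.Binary.Sublist.Propositional.Properties using (take-⊆)
open import Data.List.Relation.Binary.Subset.Propositional using (_⊆_)
open import Data.List.Membership.Propositional using (_∈_)
open import Data.List.Membership.Propositional.Properties using (∈-filter⁺; ∈-filter⁻; ∈-++⁺ˡ; ∈-++⁺ʳ; ∈-++⁻)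
open import Data.Fin using (zero; suc; inject≤)
open import Data.Maybe using (Maybe; just; nothing)
open import Data.Product using (_×_; _,_; proj₁; proj₂; ∃-syntax)
open import Data.Sum using ([_,_]′; swap)
open import Data.Empty using (⊥; ⊥-elim)
open import Relation.Nullary using (yes; no; ¬_; ¬?)
open import Relation.Unary using (Decidable)
open import Relation.Binary.PropositionalEquality using (_≡_; _≢_; refl; sym; trans; cong; cong₂; subst)
open Relation.Binary.PropositionalEquality.≡-Reasoning

filter-comm : ∀ {A : Set} {P Q : A → Set} (P? : Decidable P) (Q? : Decidable Q) (xs : List A) →
              filter P? (filter Q? xs) ≡ filter Q? (filter P? xs)
filter-comm P? Q? [] = refl
filter-comm P? Q? (x ∷ xs) with P? x | Q? x
... | yes p  | yes q  =
  trans (filter-accept P? p) (trans (cong (x ∷_) (filter-comm P? Q? xs)) (sym (filter-accept Q? q)))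
... | yes _  | no ¬q  = trans (filter-comm P? Q? xs) (sym (filter-reject Q? ¬q))
... | no ¬p  | yes _  = trans (filter-reject P? ¬p) (filter-comm P? Q? xs)
... | no _   | no _   = filter-comm P? Q? xs

All-reverse : ∀ {A : Set} {P : A → Set} {xs : List A} → All P xs → All P (reverse xs)
All-reverse Pxs = All.tabulate (All.lookup Pxs ∘ reverse⁻)

AllPairs-reverse : ∀ {A : Set} {R : A → A → Set} {xs : List A} → AllPairs R xs → AllPairs (flip R) (reverse xs)
AllPairs-reverse [] = []
AllPairs-reverse {xs = x ∷ xs} (Rx ∷ Rxs) rewrite unfold-reverse x xs =
  AllPairs.++⁺ (AllPairs-reverse Rxs) ([] ∷ []) (All.map (_∷ []) (All-reverse Rx))

LargestBelow : ℕ → List ℕ → Maybe ℕ → Set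
LargestBelow s V nothing  = ∀ {u} → u ∈ V → ¬ u < s
LargestBelow s V (just t) = t ∈ V × t < s × (∀ {u} → u ∈ V → u < s → u ≤ t)

LargestBelow-unique : ∀ {s V r r′} → LargestBelow s V r → LargestBelow s V r′ → r ≡ r′
LargestBelow-unique {r = nothing} {nothing} _ _ = refl
LargestBelow-unique {r = nothing} {just _} none (t∈V , t<s , _) = ⊥-elim (none t∈V t<s)
LargestBelow-unique {r = just _} {nothing} (t∈V , t<s , _) none = ⊥-elim (none t∈V t<s)
LargestBelow-unique {r = just _} {just _} (t∈V , t<s , t-max) (t′∈V , t′<s , t′-max) =
  cong just (≤-antisym (t′-max t∈V t<s) (t-max t′∈V t′<s))

LargestBelow-∷-≮ : ∀ {s t V} r → ¬ t < s → LargestBelow s V r → LargestBelow s (t ∷ V) r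
LargestBelow-∷-≮ nothing t≮s none (here refl) = t≮s
LargestBelow-∷-≮ nothing t≮s none (there u∈V) = none u∈V
LargestBelow-∷-≮ (just v) t≮s (v∈V , v<s , v-max) = there v∈V , v<s , λ
  { (here refl) u<s → ⊥-elim (t≮s u<s)
  ; (there u∈V) u<s → v-max u∈V u<s }

largestBelow-spec : ∀ s V → LargestBelow s V (largestBelow s V)
largestBelow-spec s [] ()
largestBelow-spec s (t ∷ V) with largestBelow s V | largestBelow-spec s V | t <? s
... | r | ih | no t≮s = LargestBelow-∷-≮ r t≮s ih
... | nothing | none | yes t<s = here refl , t<s , λ
  { (here refl) _ → ≤-refl
  ; (there u∈V) u<s → ⊥-elim (none u∈V u<s) }
... | just v | (v∈V , v<s , v-max) | yes t<s with v <? t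
...   | yes v<t = here refl , t<s , λ
  { (here refl) _ → ≤-refl
  ; (there u∈V) u<s → ≤-trans (v-max u∈V u<s) (<⇒≤ v<t) }
...   | no v≮t = there v∈V , v<s , λ
  { (here refl) _ → ≮⇒≥ v≮t
  ; (there u∈V) u<s → v-max u∈V u<s }

largestBelow-unique : ∀ {s V r} → LargestBelow s V r → largestBelow s V ≡ r
largestBelow-unique = LargestBelow-unique (largestBelow-spec _ _)

largestBelow-≥ : ∀ {s V w} → w ∈ V → w < s → ∃[ v ] largestBelow s V ≡ just v × w ≤ v
largestBelow-≥ {s} {V} w∈V w<s with largestBelow s V | largestBelow-spec s V
... | nothing | none = ⊥-elim (none w∈V w<s)
... | just v | (_ , _ , v-max) = v , refl , v-max w∈V w<s

module _ {P : ℕ → Set} (P? : Decidable P) where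

  largestBelow-filter : ∀ {s} V → (∀ {u} → u < s → P u) → largestBelow s (filter P? V) ≡ largestBelow s V
  largestBelow-filter {s} V P-below with largestBelow s V | largestBelow-spec s V
  ... | nothing | none = largestBelow-unique (none ∘ proj₁ ∘ ∈-filter⁻ P?)
  ... | just t | (t∈V , t<s , t-max) = largestBelow-unique
    (∈-filter⁺ P? t∈V (P-below t<s) , t<s , t-max ∘ proj₁ ∘ ∈-filter⁻ P?)

  largestBelow-filter-just : ∀ {s} V {t} → largestBelow s V ≡ just t → P t →
                             largestBelow s (filter P? V) ≡ just t
  largestBelow-filter-just {s} V picked Pt with subst (LargestBelow s V) picked (largestBelow-spec s V)
  ... | t∈V , t<s , t-max = largestBelow-unique (∈-filter⁺ P? t∈V Pt , t<s , t-max ∘ proj₁ ∘ ∈-filter⁻ P?)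

∈-removeElt⁺ : ∀ {u t V} → u ∈ V → u ≢ t → u ∈ removeElt t V
∈-removeElt⁺ {t = t} = ∈-filter⁺ (λ u → ¬? (u ≟ t))

∈-removeElt⁻ : ∀ {u t V} → u ∈ removeElt t V → u ∈ V
∈-removeElt⁻ {t = t} = proj₁ ∘ ∈-filter⁻ (λ u → ¬? (u ≟ t))

removeElt-filter : ∀ {P : ℕ → Set} (P? : Decidable P) t V → removeElt t (filter P? V) ≡ filter P? (removeElt t V)
removeElt-filter P? t = filter-comm (λ u → ¬? (u ≟ t)) P?

go-⊆ : ∀ V ss → go V ss ⊆ V
go-⊆ V [] ()
go-⊆ V (s ∷ ss) n∈ with largestBelow s V | largestBelow-spec s V
go-⊆ V (s ∷ ss) n∈          | nothing | _ = go-⊆ V ss n∈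
go-⊆ V (s ∷ ss) (here refl) | just t | (t∈V , _) = t∈V
go-⊆ V (s ∷ ss) (there n∈)  | just t | _ = ∈-removeElt⁻ (go-⊆ (removeElt t V) ss n∈)

go-pick : ∀ V ss {s v} → largestBelow s V ≡ just v → go V (s ∷ ss) ≡ v ∷ go (removeElt v V) ss
go-pick V ss picked rewrite picked = refl

go-filter : ∀ {P : ℕ → Set} (P? : Decidable P) V ss → All (λ s → ∀ {u} → u < s → P u) ss →
            go (filter P? V) ss ≡ go V ss
go-filter P? V [] [] = refl
go-filter P? V (s ∷ ss) (P-below ∷ Ps-below) rewrite largestBelow-filter P? V P-below with largestBelow s V
... | nothing = go-filter P? V ss Ps-below
... | just t = cong (t ∷_) (begin
  go (removeElt t (filter P? V)) ss  ≡⟨ cong (λ V′ → go V′ ss) (removeElt-filter P? t V) ⟩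
  go (filter P? (removeElt t V)) ss  ≡⟨ go-filter P? (removeElt t V) ss Ps-below ⟩
  go (removeElt t V) ss              ∎)

∈-≥ₓ⁻ : ∀ {x u} V → u ∈ V ≥ₓ x → u ∈ V × x ℤ.≤ + u
∈-≥ₓ⁻ {x} V = ∈-filter⁻ (λ t → x ℤP.≤? + t)

∈-<ₓ⁻ : ∀ {x u} V → u ∈ V <ₓ x → u ∈ V × + u ℤ.< x
∈-<ₓ⁻ {x} V = ∈-filter⁻ (λ t → + t ℤP.<? x)

largestBelow-≥ₓ : ∀ {x s} V {v} → largestBelow s V ≡ just v → x ℤ.≤ + v → largestBelow s (V ≥ₓ x) ≡ just v
largestBelow-≥ₓ {x} = largestBelow-filter-just (λ t → x ℤP.≤? + t)

removeElt-≥ₓ : ∀ x v V → removeElt v (V ≥ₓ x) ≡ removeElt v V ≥ₓ x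
removeElt-≥ₓ x v V = removeElt-filter (λ t → x ℤP.≤? + t) v V

removeElt-<ₓ : ∀ {x v} V → x ℤ.≤ + v → removeElt v V <ₓ x ≡ V <ₓ x
removeElt-<ₓ {x} {v} V x≤v = begin
  removeElt v V <ₓ x          ≡⟨ removeElt-filter (λ t → + t ℤP.<? x) v V ⟨
  removeElt v (V <ₓ x)        ≡⟨ filter-all (λ u → ¬? (u ≟ v)) (All.map ≢v (all-filter (λ t → + t ℤP.<? x) V)) ⟩
  V <ₓ x                      ∎
  where
    ≢v : ∀ {u} → + u ℤ.< x → u ≢ v
    ≢v u<x refl = ℤP.<⇒≱ u<x x≤v

go-++-split : ∀ x V {W ss} rest → Pointwise _<_ W ss → AllPairs _>_ W → W ⊆ V ≥ₓ x →
              All (λ s → + s ℤ.≤ x) rest →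
              go V (ss ++ rest) ≡ go (V ≥ₓ x) ss ++ go (V <ₓ x) rest
go-++-split x V rest [] [] _ rest≤x = sym (go-filter (λ t → + t ℤP.<? x) V rest
  (All.map (λ s≤x {_} u<s → ℤP.<-≤-trans (+<+ u<s) s≤x) rest≤x))
go-++-split x V {w ∷ W} {s ∷ ss} rest (w<s ∷ W<ss) (w>W ∷ W↘) W⊆V≥x rest≤x
  with ∈-≥ₓ⁻ V (W⊆V≥x (here refl))
... | w∈V , x≤w with largestBelow-≥ w∈V w<s
... | v , picked , w≤v = begin
  go V (s ∷ ss ++ rest)
    ≡⟨ go-pick V (ss ++ rest) picked ⟩
  v ∷ go (removeElt v V) (ss ++ rest)
    ≡⟨ cong (v ∷_) (go-++-split x (removeElt v V) rest W<ss W↘ W⊆V′≥x rest≤x) ⟩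
  v ∷ go (removeElt v V ≥ₓ x) ss ++ go (removeElt v V <ₓ x) rest
    ≡⟨ cong₂ (λ A B → v ∷ go A ss ++ go B rest) (sym (removeElt-≥ₓ x v V)) (removeElt-<ₓ V x≤v) ⟩
  v ∷ go (removeElt v (V ≥ₓ x)) ss ++ go (V <ₓ x) rest
    ≡⟨ cong (_++ go (V <ₓ x) rest) (go-pick (V ≥ₓ x) ss (largestBelow-≥ₓ V picked x≤v)) ⟨
  go (V ≥ₓ x) (s ∷ ss) ++ go (V <ₓ x) rest ∎
  where
    x≤v : x ℤ.≤ + v
    x≤v = ℤP.≤-trans x≤w (+≤+ w≤v)

    -- the remaining witnesses lie below w ≤ v, so removing v keeps them
    W⊆V′≥x : W ⊆ removeElt v V ≥ₓ x
    W⊆V′≥x u∈W = subst (_ ∈_) (removeElt-≥ₓ x v V)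
      (∈-removeElt⁺ (W⊆V≥x (there u∈W)) (<⇒≢ (<-≤-trans (All.lookup w>W u∈W) w≤v)))

⪯⇒take-Pointwise : ∀ {T S} → T ⪯ S → Pointwise _<_ (take (length S) T) S
⪯⇒take-Pointwise {T} {S} T⪯S = take-pointwise T S len≥ pointwise
  where
    open _⪯_ T⪯S
    take-pointwise : ∀ T S (len≥ : length S ≤ length T) →
                     (∀ i → lookup T (inject≤ i len≥) < lookup S i) →
                     Pointwise _<_ (take (length S) T) S
    take-pointwise T       []      _          _   = []
    take-pointwise []      (_ ∷ _) ()         _
    take-pointwise (_ ∷ T) (_ ∷ S) (s≤s len≥) T<S = T<S zero ∷ take-pointwise T S len≥ (T<S ∘ suc)

⪯⇒decreasing-witnesses : ∀ {T S} → AllPairs _<_ T → T ⪯ S →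
                         let W = reverse (take (length S) T)
                         in Pointwise _<_ W (reverse S) × AllPairs _>_ W × W ⊆ T
⪯⇒decreasing-witnesses {T} {S} T↗ T⪯S =
  Pointwise.reverse⁺ (⪯⇒take-Pointwise T⪯S) ,
  AllPairs-reverse (AllPairs.take⁺ (length S) T↗) ,
  Sublist.lookup (take-⊆ (length S) T) ∘ reverse⁻

≤ₓ-++->ₓ : ∀ x {S} → AllPairs _<_ S → (S ≤ₓ x) ++ (S >ₓ x) ≡ S
≤ₓ-++->ₓ x [] = refl
≤ₓ-++->ₓ x {s ∷ S} (s<S ∷ S↗) with + s ℤP.≤? x | x ℤP.<? + s
... | yes s≤x | yes x<s = ⊥-elim (ℤP.<⇒≱ x<s s≤x)
... | yes _   | no _    = cong (s ∷_) (≤ₓ-++->ₓ x S↗)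
... | no s≰x  | no x≮s  = ⊥-elim (x≮s (ℤP.≰⇒> s≰x))
... | no _    | yes x<s = cong₂ (λ A B → A ++ s ∷ B)
  (filter-none (λ u → + u ℤP.≤? x) (All.map ℤP.<⇒≱ x<S))
  (filter-all (λ u → x ℤP.<? + u) x<S)
  where
    x<S : All (λ u → x ℤ.< + u) S
    x<S = All.map (ℤP.<-trans x<s ∘ +<+) s<S

++⇒⊔ : ∀ {C A B} → C ≡ B ++ A → (∀ n → n ∈ A → n ∈ B → ⊥) → C ≡ A ⊔ B
++⇒⊔ {B = B} refl A∩B≡∅ = (λ _ → swap ∘ ∈-++⁻ B) , (λ _ → [ ∈-++⁺ʳ B , ∈-++⁺ˡ ]′) , A∩B≡∅

proposition4p12 : (T S : List ℕ) → IsFinSetPos T → IsFinSetPos S → (x : ℤ) →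
                  (T ≥ₓ x) ⪯ (S >ₓ x) →
                  (T ◁ S) ≡ ((T <ₓ x) ◁ (S ≤ₓ x)) ⊔ ((T ≥ₓ x) ◁ (S >ₓ x))
proposition4p12 T S (T↗ , _) (S↗ , _) x T≥x⪯S>x = ++⇒⊔ split disjoint
  where
    T≥x↗ : AllPairs _<_ (T ≥ₓ x)
    T≥x↗ = AllPairs.filter⁺ (λ t → x ℤP.≤? + t) (Linked⇒AllPairs <-trans T↗)

    split : T ◁ S ≡ (T ≥ₓ x) ◁ (S >ₓ x) ++ (T <ₓ x) ◁ (S ≤ₓ x)
    split with ⪯⇒decreasing-witnesses T≥x↗ T≥x⪯S>x
    ... | W<S , W↘ , W⊆T≥x = begin
      go T (reverse S)
        ≡⟨ cong (go T ∘ reverse) (≤ₓ-++->ₓ x (Linked⇒AllPairs <-trans S↗)) ⟨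
      go T (reverse ((S ≤ₓ x) ++ (S >ₓ x)))
        ≡⟨ cong (go T) (reverse-++ (S ≤ₓ x) (S >ₓ x)) ⟩
      go T (reverse (S >ₓ x) ++ reverse (S ≤ₓ x))
        ≡⟨ go-++-split x T _ W<S W↘ W⊆T≥x (All-reverse (all-filter (λ s → + s ℤP.≤? x) S)) ⟩
      (T ≥ₓ x) ◁ (S >ₓ x) ++ (T <ₓ x) ◁ (S ≤ₓ x) ∎

    disjoint : ∀ n → n ∈ (T <ₓ x) ◁ (S ≤ₓ x) → n ∈ (T ≥ₓ x) ◁ (S >ₓ x) → ⊥
    disjoint n n∈A n∈B = ℤP.<⇒≱
      (proj₂ (∈-<ₓ⁻ T (go-⊆ (T <ₓ x) (reverse (S ≤ₓ x)) n∈A)))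
      (proj₂ (∈-≥ₓ⁻ T (go-⊆ (T ≥ₓ x) (reverse (S >ₓ x)) n∈B)))
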